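{- Let $I=(E,\mathcal{I},c,T)$ be an EMB instance and let $P=(\mathrm{opt},\mathcal{F},\triangleleft)\in\mathcal{Q}$. Then: (1) if there is a solution $S$ for $R_P(I)$ with $v_I(S)=k_I\cdot H_I+T$, then $I$ is a yes-instance; (2) if $I$ is a yes-instance, then (i) $R_P(I)$ has a solution, and (ii) every $(1+\varepsilon_I)$-approximate solution $S$ for $R_P(I)$ satisfies $v_I(S)=k_I\cdot H_I+T$.
   Context: A matroid is a pair $(E,\mathcal{I})$ with $E$ finite, $\emptyset\in\mathcal{I}\subseteq2^E$, closed under subsets, with the exchange property; for $\mathcal{M}=(E,\mathcal{I})$, $\mathrm{IS}(\mathcal{M})=\mathcal{I}$, $\mathrm{bases}(\mathcal{M})$ is the set of independent sets of maximum cardinality. For a function $f$ on $E$ and $Y\subseteq E$, $f(Y)=\sum_{e\in Y}f(e)$. EMB instance: $(E,\mathcal{I},c,T)$ with $(E,\mathcal{I})$ a matroid, $c:E\to\mathbb{N}$, $T\in\mathbb{N}$; a solution is a basis $S$ with $c(S)=T$; it is a yes-instance iff a solution exists. $\mathcal{P}=\{\max,\min\}\times\{\mathrm{bases},\mathrm{IS}\}\times\{\le,\ge\}$, $\mathcal{Q}=\mathcal{P}\setminus\{(\min,\mathrm{IS},\le)\}$. For $P=(\mathrm{opt},\mathcal{F},\triangleleft)$, a $P$-MOL instance is $(E,\mathcal{I},v,w,L)$ with $(E,\mathcal{I})$ a matroid $\mathcal{M}$, $v,w:E\to\mathbb{R}_{\ge0}$, $L\in\mathbb{R}_{\ge0}$;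 a solution is $S\in\mathcal{F}(\mathcal{M})$ with $w(S)\triangleleft L$; the goal is to optimize ($\mathrm{opt}$) $v(S)$. A $\rho$-approximate solution ($\rho\ge1$) is a solution of value $\ge\mathrm{OPT}/\rho$ if $\mathrm{opt}=\max$, or $\le\rho\cdot\mathrm{OPT}$ if $\mathrm{opt}=\min$. Reduction: given EMB instance $I=(E,\mathcal{I},c,T)$ and $P\in\mathcal{Q}$, let $d(P)=0$ if ($\mathrm{opt}=\max$ and $\triangleleft$ is $\le$) or ($\mathrm{opt}=\min$ and $\triangleleft$ is $\ge$), and $d(P)=1$ otherwise; $H_I=2\max\{1,c(E)\}$; $v_I(e)=H_I+c(e)$; $w_{I,P}(e)=H_I+c(e)(-1)^{d(P)}$; $k_I=\max_{S\in\mathcal{I}}|S|$; $L_{I,P}=k_I H_I+T(-1)^{d(P)}$; and $R_P(I)=(E,\mathcal{I},v_I,w_{I,P},L_{I,P})$. Finally $\varepsilon_I=\frac{1}{8(|E|+1)(T+1)(c(E)+1)}$. -}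

module Defs where

open import Data.Nat as ℕ using (ℕ; zero; suc; _+_; _*_; _≤_; _<_)
open import Data.Integer as ℤ using (ℤ; +_; -_)
open import Data.Bool using (Bool; true; false)
open import Data.Fin using (Fin)
import Data.Fin as Fin
open import Data.Fin.Subset using (Subset; ⊥; ⊤; _∈_; _∉_; _⊆_; _∪_; ⁅_⁆; ∣_∣)
open import Data.Vec using (Vec; []; _∷_)
open import Data.Product using (Σ; _×_; ∃; _,_)
open import Relation.Binary.PropositionalEquality using (_≡_; _≢_)

record Matroid (n : ℕ) : Set₁ where
  field
    Indep      : Subset n → Set
    indep-∅    : Indep ⊥
    indep-⊆    : ∀ {A B} → A ⊆ B → Indep B → Indep A
    exchange   : ∀ {A B} → Indep A → Indep B → ∣ A ∣ < ∣ B ∣ →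
                 ∃ λ e → e ∈ B × e ∉ A × Indep (A ∪ ⁅ e ⁆)

open Matroid public

IsBasis : ∀ {n} → Matroid n → Subset n → Set
IsBasis M S = Indep M S × (∀ S′ → Indep M S′ → ∣ S′ ∣ ≤ ∣ S ∣)

IsMaxIndepSize : ∀ {n} → Matroid n → ℕ → Set
IsMaxIndepSize M k = (∃ λ S → Indep M S × ∣ S ∣ ≡ k) × (∀ S → Indep M S → ∣ S ∣ ≤ k)

sumℕ : ∀ {n} → (Fin n → ℕ) → Subset n → ℕ
sumℕ f []           = 0
sumℕ f (true  ∷ bs) = f Fin.zero + sumℕ (λ i → f (Fin.suc i)) bs
sumℕ f (false ∷ bs) = sumℕ (λ i → f (Fin.suc i)) bs

sumℤ : ∀ {n} → (Fin n → ℤ) → Subset n → ℤ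
sumℤ f []           = + 0
sumℤ f (true  ∷ bs) = f Fin.zero ℤ.+ sumℤ (λ i → f (Fin.suc i)) bs
sumℤ f (false ∷ bs) = sumℤ (λ i → f (Fin.suc i)) bs

record EMB : Set₁ where
  field
    size : ℕ
    mat  : Matroid size
    cost : Fin size → ℕ
    T    : ℕ

EMBSolution : (I : EMB) → Subset (EMB.size I) → Set
EMBSolution I S = IsBasis (EMB.mat I) S × sumℕ (EMB.cost I) S ≡ EMB.T I

YesInstance : EMB → Set
YesInstance I = ∃ λ S → EMBSolution I S

data Opt : Set where
  max min : Opt

data Fam : Set where
  bases IS : Fam

data Rel : Set where
  le ge : Rel

record Problem : Set where
  constructor prob
  field
    opt : Opt
    fam : Fam
    rel : Rel

InQ : Problem → Set
InQ P = P ≢ prob min IS le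

record MOL : Set₁ where
  field
    size : ℕ
    mat  : Matroid size
    v    : Fin size → ℕ
    w    : Fin size → ℤ
    L    : ℤ

InFam : ∀ {n} → Fam → Matroid n → Subset n → Set
InFam bases M S = IsBasis M S
InFam IS    M S = Indep M S

RelHolds : Rel → ℤ → ℤ → Set
RelHolds le x y = x ℤ.≤ y
RelHolds ge x y = x ℤ.≥ y

MOLSolution : Problem → (J : MOL) → Subset (MOL.size J) → Set
MOLSolution P J S =
  InFam (Problem.fam P) (MOL.mat J) S × RelHolds (Problem.rel P) (sumℤ (MOL.w J) S) (MOL.L J)

-- ρ-approximate solution, with ρ = num / den (den ≥ 1, num ≥ den).
-- OPT is the optimum of v over all solutions; "v(S) ≥ OPT/ρ" is written as
-- den · v(S′) ≤ num · v(S) for every solution S′ (max), and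
-- "v(S) ≤ ρ · OPT" as den · v(S) ≤ num · v(S′) for every solution S′ (min).
IsApproxBy : Opt → Problem → (J : MOL) → (num den : ℕ) → Subset (MOL.size J) → Set
IsApproxBy max P J num den S = MOLSolution P J S ×
  (∀ S′ → MOLSolution P J S′ → den * sumℕ (MOL.v J) S′ ≤ num * sumℕ (MOL.v J) S)
IsApproxBy min P J num den S = MOLSolution P J S ×
  (∀ S′ → MOLSolution P J S′ → den * sumℕ (MOL.v J) S ≤ num * sumℕ (MOL.v J) S′)

IsApprox : Problem → (J : MOL) → (num den : ℕ) → Subset (MOL.size J) → Set
IsApprox P = IsApproxBy (Problem.opt P) P

sgn : Problem → ℤ
sgn (prob max _ le) = + 1
sgn (prob min _ ge) = + 1
sgn (prob max _ ge) = - (+ 1)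
sgn (prob min _ le) = - (+ 1)

cE : EMB → ℕ
cE I = sumℕ (EMB.cost I) ⊤

H : EMB → ℕ
H I = 2 * (1 ℕ.⊔ cE I)

vI : (I : EMB) → Fin (EMB.size I) → ℕ
vI I e = H I + EMB.cost I e

wIP : (I : EMB) → Problem → Fin (EMB.size I) → ℤ
wIP I P e = + H I ℤ.+ (+ EMB.cost I e) ℤ.* sgn P

-- L_{I,P}, with k = k_I supplied (characterised by IsMaxIndepSize)
LIP : (I : EMB) → Problem → (k : ℕ) → ℤ
LIP I P k = + (k * H I) ℤ.+ (+ EMB.T I) ℤ.* sgn P

R : Problem → (I : EMB) → (k : ℕ) → MOL
R P I k = record
  { size = EMB.size I
  ; mat  = EMB.mat I
  ; v    = vI I
  ; w    = wIP I P
  ; L    = LIP I P k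
  }

-- ε_I = 1 / D_I with D_I = 8(|E|+1)(T+1)(c(E)+1); so 1 + ε_I = (D_I + 1) / D_I
D : EMB → ℕ
D I = 8 * (EMB.size I + 1) * (EMB.T I + 1) * (cE I + 1)

{-# OPTIONS --safe #-}
module Submission where

-- The values v_I(S) = |S|·H_I + c(S) and weights w_{I,P}(S) = |S|·H_I ± c(S) are numbers
-- written in base H_I: since c(S) ≤ c(E) < H_I, the high digit is |S| and the low digit
-- is c(S).  Hence v_I(S) = k_I·H_I + T forces |S| = k_I and c(S) = T, i.e. S is an EMB
-- solution.  Conversely an EMB solution S* has v_I(S*) = k_I·H_I + T and w(S*) = L, so it
-- is feasible; digit comparison shows that every feasible S has v_I(S) ≤ k_I·H_I + T when
-- opt = max (≥ when opt = min).  As k_I·H_I + T < 1/ε_I, an integer within a factor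
-- 1 + ε_I of that bound must equal it.

open import Defs
open import Data.Nat using (ℕ; suc; _+_; _*_; _≤_; _<_; _⊔_; z≤n; z<s)
open import Data.Nat.Properties
open import Data.Nat.Solver using (module +-*-Solver)
open import Data.Integer as ℤ using (+_; 1ℤ; -1ℤ)
import Data.Integer.Properties as ℤ
import Data.Integer.Solver as ℤ-Solver
open import Data.Fin as Fin using (Fin)
open import Data.Fin.Subset using (Subset; ⊤; ∣_∣)
open import Data.Fin.Subset.Properties using (∣p∣≤n)
open import Data.Bool using (true; false)
open import Data.Vec using ([]; _∷_)
open import Data.Product using (_×_; ∃; _,_; proj₁; proj₂)
open import Data.Sum using (inj₁; inj₂)
open import Relation.Binary.PropositionalEquality
  using (_≡_; refl; sym; trans; cong; cong₂; subst; subst₂; module ≡-Reasoning)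
open import Relation.Nullary using (contradiction)

sumℕ-const+ : ∀ {n} a (f : Fin n → ℕ) (S : Subset n) →
  sumℕ (λ e → a + f e) S ≡ ∣ S ∣ * a + sumℕ f S
sumℕ-const+ a f []          = refl
sumℕ-const+ a f (false ∷ S) = sumℕ-const+ a (λ i → f (Fin.suc i)) S
sumℕ-const+ a f (true ∷ S)
  rewrite sumℕ-const+ a (λ i → f (Fin.suc i)) S =
  solve 4 (λ a x s y → a :+ x :+ (s :* a :+ y) := a :+ s :* a :+ (x :+ y))
    refl a (f Fin.zero) ∣ S ∣ (sumℕ (λ i → f (Fin.suc i)) S)
  where open +-*-Solver

sumℤ-affine : ∀ {n} a (f : Fin n → ℕ) s (S : Subset n) →
  sumℤ (λ e → + a ℤ.+ + f e ℤ.* s) S ≡ + (∣ S ∣ * a) ℤ.+ + sumℕ f S ℤ.* s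
sumℤ-affine a f s []          = sym (ℤ.*-zeroˡ s)
sumℤ-affine a f s (false ∷ S) = sumℤ-affine a (λ i → f (Fin.suc i)) s S
sumℤ-affine a f s (true ∷ S)
  rewrite sumℤ-affine a (λ i → f (Fin.suc i)) s S =
  solve 5 (λ a x s q y → a :+ x :* s :+ (q :+ y :* s) := a :+ q :+ (x :+ y) :* s)
    refl (+ a) (+ f Fin.zero) s (+ (∣ S ∣ * a)) (+ sumℕ (λ i → f (Fin.suc i)) S)
  where open ℤ-Solver.+-*-Solver

sumℕ≤sumℕ-⊤ : ∀ {n} (f : Fin n → ℕ) (S : Subset n) → sumℕ f S ≤ sumℕ f ⊤
sumℕ≤sumℕ-⊤ f []          = z≤n
sumℕ≤sumℕ-⊤ f (true ∷ S)  =
  +-monoʳ-≤ (f Fin.zero) (sumℕ≤sumℕ-⊤ (λ i → f (Fin.suc i)) S)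
sumℕ≤sumℕ-⊤ f (false ∷ S) =
  ≤-trans (sumℕ≤sumℕ-⊤ (λ i → f (Fin.suc i)) S) (m≤n+m _ (f Fin.zero))

+m+n*σ≡+[m+n] : ∀ m n {σ} → σ ≡ 1ℤ → + m ℤ.+ + n ℤ.* σ ≡ + (m + n)
+m+n*σ≡+[m+n] m n refl = cong (ℤ._+_ (+ m)) (ℤ.*-identityʳ (+ n))

[m-n]≤[o-p]⇒m+p≤o+n : ∀ m n o p →
  + m ℤ.+ + n ℤ.* -1ℤ ℤ.≤ + o ℤ.+ + p ℤ.* -1ℤ → m + p ≤ o + n
[m-n]≤[o-p]⇒m+p≤o+n m n o p ineq =
  ℤ.drop‿+≤+ (subst₂ ℤ._≤_ (cancelˡ (+ m) (+ n) (+ p)) (cancelʳ (+ o) (+ n) (+ p))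
    (ℤ.+-monoˡ-≤ (+ n ℤ.+ + p) ineq))
  where
  open ℤ-Solver.+-*-Solver
  cancelˡ : ∀ x y z → x ℤ.+ y ℤ.* -1ℤ ℤ.+ (y ℤ.+ z) ≡ x ℤ.+ z
  cancelˡ = solve 3 (λ x y z → x :+ y :* con -1ℤ :+ (y :+ z) := x :+ z) refl
  cancelʳ : ∀ x y z → x ℤ.+ z ℤ.* -1ℤ ℤ.+ (y ℤ.+ z) ≡ x ℤ.+ y
  cancelʳ = solve 3 (λ x y z → x :+ z :* con -1ℤ :+ (y :+ z) := x :+ y) refl

high-digit-≡ : ∀ {s k h t} → s ≤ k → t < h → k * h ≤ s * h + t → s ≡ k
high-digit-≡ {s} {k} {h} {t} s≤k t<h kh≤sh+t with m≤n⇒m<n∨m≡n s≤k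
... | inj₂ s≡k = s≡k
... | inj₁ s<k = contradiction kh≤sh+t (<⇒≱ (begin-strict
  s * h + t  <⟨ +-monoʳ-< (s * h) t<h ⟩
  s * h + h  ≡⟨ +-comm (s * h) h ⟩
  suc s * h  ≤⟨ *-monoˡ-≤ h s<k ⟩
  k * h      ∎))
  where open ≤-Reasoning

≤-ratio-bounded⇒≡ : ∀ {x y d} → x ≤ y → d * y ≤ (d + 1) * x → x < d → x ≡ y
≤-ratio-bounded⇒≡ {x} {y} {d} x≤y dy≤[d+1]x x<d with m≤n⇒m<n∨m≡n x≤y
... | inj₂ x≡y = x≡y
... | inj₁ x<y = contradiction x<d (≤⇒≯ (+-cancelˡ-≤ (d * x) d x (begin
  d * x + d      ≡⟨ +-comm (d * x) d ⟩
  d + d * x      ≡⟨ *-suc d x ⟨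
  d * suc x      ≤⟨ *-monoʳ-≤ d x<y ⟩
  d * y          ≤⟨ dy≤[d+1]x ⟩
  (d + 1) * x    ≡⟨ *-distribʳ-+ x d 1 ⟩
  d * x + 1 * x  ≡⟨ cong (_+_ (d * x)) (*-identityˡ x) ⟩
  d * x + x      ∎)))
  where open ≤-Reasoning

m<2*[1⊔m] : ∀ m → m < 2 * (1 ⊔ m)
m<2*[1⊔m] m = begin-strict
  m                    <⟨ n<1+n m ⟩
  1 + m                ≤⟨ +-mono-≤ (m≤m⊔n 1 m) (m≤n⊔m 1 m) ⟩
  (1 ⊔ m) + (1 ⊔ m)    ≡⟨ cong (_+_ (1 ⊔ m)) (+-identityʳ (1 ⊔ m)) ⟨
  2 * (1 ⊔ m)          ∎
  where open ≤-Reasoning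

2*[1⊔m]≤2*[1+m] : ∀ m → 2 * (1 ⊔ m) ≤ 2 * (1 + m)
2*[1⊔m]≤2*[1+m] m = *-monoʳ-≤ 2 (m⊔n≤m+n 1 m)

k*h+t<8[n+1][t+1][y+1] : ∀ {k n h y} t → k ≤ n → h ≤ 2 * (1 + y) →
  k * h + t < 8 * (n + 1) * (t + 1) * (y + 1)
k*h+t<8[n+1][t+1][y+1] {k} {n} {h} {y} t k≤n h≤2[1+y] = begin-strict
  k * h + t                        ≤⟨ +-monoˡ-≤ t (*-mono-≤ k≤n h≤2[1+y]) ⟩
  n * (2 * (1 + y)) + t            <⟨ m<m+n _ z<s ⟩
  n * (2 * (1 + y)) + t + slack    ≡⟨ expand ⟩
  8 * (n + 1) * (t + 1) * (y + 1)  ∎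
  where
  open ≤-Reasoning
  open +-*-Solver
  slack : ℕ
  slack = 1 + 6 * n * (y + 1) + 8 * y + 7 + t * (8 * n * y + 8 * n + 8 * y + 7)
  expand : n * (2 * (1 + y)) + t + slack ≡ 8 * (n + 1) * (t + 1) * (y + 1)
  expand = solve 3 (λ n y t → n :* (con 2 :* (con 1 :+ y)) :+ t
      :+ (con 1 :+ con 6 :* n :* (y :+ con 1) :+ con 8 :* y :+ con 7
          :+ t :* (con 8 :* n :* y :+ con 8 :* n :+ con 8 :* y :+ con 7))
    := con 8 :* (n :+ con 1) :* (t :+ con 1) :* (y :+ con 1)) refl n y t

module MaxIndepSize {n} {M : Matroid n} {k} (maxSize : IsMaxIndepSize M k) where

  basis-size≡ : ∀ {S} → IsBasis M S → ∣ S ∣ ≡ k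
  basis-size≡ (indep , maximal) with proj₁ maxSize
  ... | W , indepW , ∣W∣≡k =
    ≤-antisym (proj₂ maxSize _ indep) (subst (_≤ _) ∣W∣≡k (maximal W indepW))

  maxIndepSize≤n : k ≤ n
  maxIndepSize≤n with proj₁ maxSize
  ... | W , _ , ∣W∣≡k = subst (_≤ n) ∣W∣≡k (∣p∣≤n W)

InFam⇒Indep : ∀ {n} f {M : Matroid n} {S} → InFam f M S → Indep M S
InFam⇒Indep bases = proj₁
InFam⇒Indep IS    indep = indep

RelHolds-reflexive : ∀ r {x y} → x ≡ y → RelHolds r x y
RelHolds-reflexive le x≡y = ℤ.≤-reflexive x≡y
RelHolds-reflexive ge x≡y = ℤ.≤-reflexive (sym x≡y)

module Reduction (I : EMB) {k : ℕ} (maxSize : IsMaxIndepSize (EMB.mat I) k) where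
  open EMB I using (size; mat; cost; T)
  open MaxIndepSize {M = mat} maxSize

  value : Subset size → ℕ
  value = sumℕ (vI I)

  target : ℕ
  target = k * H I + T

  value-digits : ∀ S → value S ≡ ∣ S ∣ * H I + sumℕ cost S
  value-digits = sumℕ-const+ (H I) cost

  weight-digits : ∀ P S →
    sumℤ (wIP I P) S ≡ + (∣ S ∣ * H I) ℤ.+ + sumℕ cost S ℤ.* sgn P
  weight-digits P = sumℤ-affine (H I) cost (sgn P)

  positive-weight≡value : ∀ P → sgn P ≡ 1ℤ → ∀ S → sumℤ (wIP I P) S ≡ + value S
  positive-weight≡value P sgn≡1 S = begin
    sumℤ (wIP I P) S                             ≡⟨ weight-digits P S ⟩
    + (∣ S ∣ * H I) ℤ.+ + sumℕ cost S ℤ.* sgn P  ≡⟨ +m+n*σ≡+[m+n] (∣ S ∣ * H I) _ sgn≡1 ⟩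
    + (∣ S ∣ * H I + sumℕ cost S)                ≡⟨ cong +_ (value-digits S) ⟨
    + value S                                    ∎
    where open ≡-Reasoning

  positive-limit≡target : ∀ P → sgn P ≡ 1ℤ → LIP I P k ≡ + target
  positive-limit≡target P = +m+n*σ≡+[m+n] (k * H I) T

  cost<H : ∀ S → sumℕ cost S < H I
  cost<H S = ≤-<-trans (sumℕ≤sumℕ-⊤ cost S) (m<2*[1⊔m] (cE I))

  target<D : target < D I
  target<D = k*h+t<8[n+1][t+1][y+1] T maxIndepSize≤n (2*[1⊔m]≤2*[1+m] (cE I))

  indep-value≡target⇒EMBSolution : ∀ {S} →
    Indep mat S → value S ≡ target → EMBSolution I S
  indep-value≡target⇒EMBSolution {S} indep value≡target =
    (indep , λ S′ indep′ → subst (∣ S′ ∣ ≤_) (sym size≡k) (proj₂ maxSize S′ indep′)) ,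
    cost≡T
    where
    digits : ∣ S ∣ * H I + sumℕ cost S ≡ k * H I + T
    digits = trans (sym (value-digits S)) value≡target
    size≡k : ∣ S ∣ ≡ k
    size≡k = high-digit-≡ (proj₂ maxSize S indep) (cost<H S)
      (≤-trans (m≤m+n (k * H I) T) (≤-reflexive (sym digits)))
    cost≡T : sumℕ cost S ≡ T
    cost≡T = +-cancelˡ-≡ (k * H I) _ _
      (subst (λ s → s * H I + sumℕ cost S ≡ target) size≡k digits)

  yes-instance : ∀ P →
    (∃ λ S → MOLSolution P (R P I k) S × value S ≡ target) → YesInstance I
  yes-instance P (S , (inFam , _) , value≡target) =
    S , indep-value≡target⇒EMBSolution (InFam⇒Indep (Problem.fam P) inFam) value≡target

  module _ {S* : Subset size} (solution : EMBSolution I S*) where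

    basis* : IsBasis mat S*
    basis* = proj₁ solution

    cost*≡T : sumℕ cost S* ≡ T
    cost*≡T = proj₂ solution

    size*≡k : ∣ S* ∣ ≡ k
    size*≡k = basis-size≡ basis*

    value*≡target : value S* ≡ target
    value*≡target =
      trans (value-digits S*) (cong₂ (λ s c → s * H I + c) size*≡k cost*≡T)

    weight*≡limit : ∀ P → sumℤ (wIP I P) S* ≡ LIP I P k
    weight*≡limit P = trans (weight-digits P S*)
      (cong₂ (λ s c → + (s * H I) ℤ.+ + c ℤ.* sgn P) size*≡k cost*≡T)

    T<H : T < H I
    T<H = subst (_< H I) cost*≡T (cost<H S*)

    feasible : ∀ P → MOLSolution P (R P I k) S*
    feasible P@(prob _ bases r) = basis* , RelHolds-reflexive r (weight*≡limit P)
    feasible P@(prob _ IS r)    = proj₁ basis* , RelHolds-reflexive r (weight*≡limit P)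

    max-feasible⇒value≤target : ∀ {f r} S →
      MOLSolution (prob max f r) (R (prob max f r) I k) S → value S ≤ target
    max-feasible⇒value≤target {f} {le} S (_ , w≤L) = ℤ.drop‿+≤+ (subst₂ ℤ._≤_
      (positive-weight≡value (prob max f le) refl S)
      (positive-limit≡target (prob max f le) refl) w≤L)
    max-feasible⇒value≤target {f} {ge} S (inFam , L≤w) = begin
      value S                    ≡⟨ value-digits S ⟩
      ∣ S ∣ * H I + sumℕ cost S  ≡⟨ cong (λ s → s * H I + sumℕ cost S) size≡k ⟩
      k * H I + sumℕ cost S      ≤⟨ subst (λ s → k * H I + sumℕ cost S ≤ s * H I + T)
                                       size≡k kH+c≤sH+T ⟩
      target                     ∎
      where
      open ≤-Reasoning
      kH+c≤sH+T : k * H I + sumℕ cost S ≤ ∣ S ∣ * H I + T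
      kH+c≤sH+T = [m-n]≤[o-p]⇒m+p≤o+n (k * H I) T (∣ S ∣ * H I) (sumℕ cost S)
        (subst (LIP I (prob max f ge) k ℤ.≤_) (weight-digits (prob max f ge) S) L≤w)
      size≡k : ∣ S ∣ ≡ k
      size≡k = high-digit-≡ (proj₂ maxSize S (InFam⇒Indep f inFam)) T<H
        (≤-trans (m≤m+n (k * H I) (sumℕ cost S)) kH+c≤sH+T)

    -- (min, IS, ≤) is excluded from 𝒬 because the empty set is feasible there.
    min-feasible⇒target≤value : ∀ {f r} → InQ (prob min f r) → ∀ S →
      MOLSolution (prob min f r) (R (prob min f r) I k) S → target ≤ value S
    min-feasible⇒target≤value {f} {ge} _ S (_ , L≤w) = ℤ.drop‿+≤+ (subst₂ ℤ._≤_
      (positive-limit≡target (prob min f ge) refl)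
      (positive-weight≡value (prob min f ge) refl S) L≤w)
    min-feasible⇒target≤value {IS} {le} P∈Q _ _ = contradiction refl P∈Q
    min-feasible⇒target≤value {bases} {le} _ S (basis , w≤L) = begin
      target                     ≤⟨ subst (λ s → s * H I + T ≤ k * H I + sumℕ cost S)
                                       size≡k sH+T≤kH+c ⟩
      k * H I + sumℕ cost S      ≡⟨ cong (λ s → s * H I + sumℕ cost S) size≡k ⟨
      ∣ S ∣ * H I + sumℕ cost S  ≡⟨ value-digits S ⟨
      value S                    ∎
      where
      open ≤-Reasoning
      size≡k : ∣ S ∣ ≡ k
      size≡k = basis-size≡ basis
      sH+T≤kH+c : ∣ S ∣ * H I + T ≤ k * H I + sumℕ cost S
      sH+T≤kH+c = [m-n]≤[o-p]⇒m+p≤o+n (∣ S ∣ * H I) (sumℕ cost S) (k * H I) T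
        (subst (ℤ._≤ LIP I (prob min bases le) k) (weight-digits (prob min bases le) S) w≤L)

    approx⇒value≡target : ∀ P → InQ P → ∀ S →
      IsApprox P (R P I k) (D I + 1) (D I) S → value S ≡ target
    approx⇒value≡target P@(prob max _ _) _ S (feasibleS , approx) =
      ≤-ratio-bounded⇒≡ value≤target
        (subst (λ v → D I * v ≤ (D I + 1) * value S) value*≡target (approx S* (feasible P)))
        (≤-<-trans value≤target target<D)
      where
      value≤target : value S ≤ target
      value≤target = max-feasible⇒value≤target S feasibleS
    approx⇒value≡target P@(prob min _ _) P∈Q S (feasibleS , approx) =
      sym (≤-ratio-bounded⇒≡ (min-feasible⇒target≤value P∈Q S feasibleS)
        (subst (λ v → D I * value S ≤ (D I + 1) * v) value*≡target (approx S* (feasible P)))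
        target<D)

theorem3p2 : (I : EMB) (P : Problem) → InQ P →
    (k : ℕ) → IsMaxIndepSize (EMB.mat I) k →
    ((∃ λ (S : Subset (EMB.size I)) →
        MOLSolution P (R P I k) S × sumℕ (vI I) S ≡ k * H I + EMB.T I)
      → YesInstance I)
    ×
    (YesInstance I →
      (∃ λ (S : Subset (EMB.size I)) → MOLSolution P (R P I k) S)
      ×
      (∀ (S : Subset (EMB.size I)) → IsApprox P (R P I k) (D I + 1) (D I) S →
        sumℕ (vI I) S ≡ k * H I + EMB.T I))
theorem3p2 I P P∈Q k maxSize =
  yes-instance P ,
  λ (S* , solution) → (S* , feasible solution P) , approx⇒value≡target solution P P∈Q
  where open Reduction I maxSize
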